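{- In $\mathrm{HS}$, the following are equivalent: (i) $\phi$ and $\psi$ are down-set incompatible on either side (i.e., $\psi$ is a down-set incompatibility of $\phi$ or $\phi$ is a down-set incompatibility of $\psi$); (ii) there is a formula $\theta$ such that $\phi\equiv \theta$ and $\psi \equiv \neg \theta$ (and $\mathsf{P}(\theta)\subseteq \mathsf{P}(\phi)\cup \mathsf{P}(\psi)$).
   Context: $\mathrm{HS}$: $\phi ::= p \mid \bot \mid \neg\phi \mid \phi\,\dot\wedge\,\phi \mid \phi\,\dot\vee\,\phi \mid \mathsf{M}\phi$, on propositional teams (sets of valuations). Support: $s\models p$ iff all $w\in s$ make $p$ true; $s\models\bot$ iff $s=\emptyset$; $s\models\neg\phi$ iff $s\models^-\phi$ (anti-support); $\dot\wedge$ supported iff both conjuncts are; $s\models\phi\,\dot\vee\,\psi$ iff $s=t\cup u$ with $t\models\phi$, $u\models\psi$; $s\models\mathsf{M}\phi$ iff not $s\models^-\phi$. Anti-support: $s\models^-\neg\phi$ iff $s\models\phi$; if the main connective of $\phi$ is not $\neg$, $s\models^-\phi$ iff every $t\subseteq s$ with $t\models\phi$ is empty. $\psi$ is a down-set incompatibility of $\chi$ if for every $s$: $s\models\psi$ iff every $t\subseteq s$ with $t\models\chi$ is empty. $\equiv$ is equivalence of support; $\mathsf{P}(\phi)$ the variables of $\phi$. -}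

module Defs where

open import Level using (Level; 0ℓ) renaming (suc to lsuc)
open import Data.Nat using (ℕ)
open import Data.Bool using (Bool; true)
open import Data.List using (List; []; [_]; _++_)
open import Data.List.Membership.Propositional using (_∈_)
open import Data.Product using (Σ; _×_; _,_)
open import Data.Sum using (_⊎_)
open import Relation.Nullary using (¬_)
open import Relation.Binary.PropositionalEquality using (_≡_)

Valuation : Set
Valuation = ℕ → Bool

Team : Set₁
Team = Valuation → Set

_⊆ᵀ_ : Team → Team → Set
t ⊆ᵀ s = ∀ w → t w → s w

IsUnion : Team → Team → Team → Set
IsUnion s t u = ∀ w → (s w → t w ⊎ u w) × (t w ⊎ u w → s w)

EmptyT : Team → Set
EmptyT s = ∀ w → ¬ s w

data Form : Set where
  var  : ℕ → Form
  bot  : Form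
  neg  : Form → Form
  _∧̇_  : Form → Form → Form
  _∨̇_  : Form → Form → Form
  M    : Form → Form

infixr 6 _∧̇_
infixr 5 _∨̇_

vars : Form → List ℕ
vars (var p) = [ p ]
vars bot = []
vars (neg φ) = vars φ
vars (φ ∧̇ ψ) = vars φ ++ vars ψ
vars (φ ∨̇ ψ) = vars φ ++ vars ψ
vars (M φ) = vars φ

_⊨_ : Team → Form → Set₁
_⊨⁻_ : Team → Form → Set₁

DownEmpty : Team → Form → Set₁
DownEmpty s φ = ∀ (t : Team) → t ⊆ᵀ s → t ⊨ φ → Level.Lift (lsuc 0ℓ) (EmptyT t)

s ⊨ var p = Level.Lift (lsuc 0ℓ) (∀ w → s w → w p ≡ true)
s ⊨ bot = Level.Lift (lsuc 0ℓ) (EmptyT s)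
s ⊨ neg φ = s ⊨⁻ φ
s ⊨ (φ ∧̇ ψ) = (s ⊨ φ) × (s ⊨ ψ)
s ⊨ (φ ∨̇ ψ) = Σ Team λ t → Σ Team λ u → Level.Lift (lsuc 0ℓ) (IsUnion s t u) × (t ⊨ φ) × (u ⊨ ψ)
s ⊨ M φ = ¬ (s ⊨⁻ φ)

s ⊨⁻ neg φ = s ⊨ φ
s ⊨⁻ var p = DownEmpty s (var p)
s ⊨⁻ bot = DownEmpty s bot
s ⊨⁻ (φ ∧̇ ψ) = DownEmpty s (φ ∧̇ ψ)
s ⊨⁻ (φ ∨̇ ψ) = DownEmpty s (φ ∨̇ ψ)
s ⊨⁻ M φ = DownEmpty s (M φ)

_⟺_ : Set₁ → Set₁ → Set₁
A ⟺ B = (A → B) × (B → A)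

IsDownSetIncompatibility : Form → Form → Set₁
IsDownSetIncompatibility ψ χ = ∀ (s : Team) → (s ⊨ ψ) ⟺ DownEmpty s χ

_≡ₛ_ : Form → Form → Set₁
φ ≡ₛ ψ = ∀ (s : Team) → (s ⊨ φ) ⟺ (s ⊨ ψ)

VarsWithin : Form → Form → Form → Set
VarsWithin θ φ ψ = ∀ n → n ∈ vars θ → n ∈ vars φ ⊎ n ∈ vars ψ

DownSetIncompatibleEitherSide : Form → Form → Set₁
DownSetIncompatibleEitherSide φ ψ =
  IsDownSetIncompatibility ψ φ ⊎ IsDownSetIncompatibility φ ψ

{-# OPTIONS --safe #-}
module Submission where

open import Defs
open import Data.List.Membership.Propositional using (_∈_)
open import Data.List.Membership.Propositional.Properties using (∈-++⁻)
open import Data.Product using (Σ; _×_; _,_; proj₁; proj₂)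
open import Data.Sum using (inj₁; inj₂; reduce) renaming (map to map-⊎)
open import Function using (id; _∘_)

-- When θ is not a negation, anti-support of θ is by definition the down-set
-- condition, so ¬θ is a down-set incompatibility of θ; for θ = ¬χ the roles
-- swap, and double negations cancel. Both relations are invariant under ≡ₛ,
-- so for (i) ⇒ (ii) it suffices to replace φ (resp. ψ) by the equivalent
-- formula φ ∧̇ φ, which is not a negation.

⟺-sym : ∀ {A B} → A ⟺ B → B ⟺ A
⟺-sym (f , g) = g , f

⟺-trans : ∀ {A B C} → A ⟺ B → B ⟺ C → A ⟺ C
⟺-trans (f , g) (h , k) = h ∘ f , g ∘ k

∧̇-idem : ∀ φ → φ ≡ₛ (φ ∧̇ φ)
∧̇-idem φ s = (λ sφ → sφ , sφ) , proj₁

vars-∧̇-idem : ∀ φ {n} → n ∈ vars (φ ∧̇ φ) → n ∈ vars φ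
vars-∧̇-idem φ = reduce ∘ ∈-++⁻ (vars φ)

-- Formula arguments are explicit: support is not injective in the formula,
-- so Agda cannot infer them from proofs of ≡ₛ.
DownEmpty-cong : ∀ φ ψ → φ ≡ₛ ψ → ∀ s → DownEmpty s φ ⟺ DownEmpty s ψ
DownEmpty-cong φ ψ φ≡ψ s =
  (λ d t t⊆s tψ → d t t⊆s (proj₂ (φ≡ψ t) tψ)) ,
  (λ d t t⊆s tφ → d t t⊆s (proj₁ (φ≡ψ t) tφ))

isDownSetIncompatibility-resp : ∀ ψ′ ψ χ′ χ → ψ′ ≡ₛ ψ → χ′ ≡ₛ χ →
  IsDownSetIncompatibility ψ χ → IsDownSetIncompatibility ψ′ χ′
isDownSetIncompatibility-resp ψ′ ψ χ′ χ ψ′≡ψ χ′≡χ incomp s =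
  ⟺-trans (ψ′≡ψ s) (⟺-trans (incomp s) (⟺-sym (DownEmpty-cong χ′ χ χ′≡χ s)))

downSetIncompatibleEitherSide-resp : ∀ φ′ φ ψ′ ψ → φ′ ≡ₛ φ → ψ′ ≡ₛ ψ →
  DownSetIncompatibleEitherSide φ ψ → DownSetIncompatibleEitherSide φ′ ψ′
downSetIncompatibleEitherSide-resp φ′ φ ψ′ ψ φ′≡φ ψ′≡ψ =
  map-⊎ (isDownSetIncompatibility-resp ψ′ ψ φ′ φ ψ′≡ψ φ′≡φ)
        (isDownSetIncompatibility-resp φ′ φ ψ′ ψ φ′≡φ ψ′≡ψ)

isDownSetIncompatibility⇒≡ₛneg-∧̇ : ∀ ψ χ →
  IsDownSetIncompatibility ψ χ → ψ ≡ₛ neg (χ ∧̇ χ)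
isDownSetIncompatibility⇒≡ₛneg-∧̇ ψ χ incomp s =
  ⟺-trans (incomp s) (DownEmpty-cong χ (χ ∧̇ χ) (∧̇-idem χ) s)

data NotNegation : Form → Set where
  var : ∀ p → NotNegation (var p)
  bot : NotNegation bot
  _∧̇_ : ∀ φ ψ → NotNegation (φ ∧̇ ψ)
  _∨̇_ : ∀ φ ψ → NotNegation (φ ∨̇ ψ)
  M   : ∀ φ → NotNegation (M φ)

neg-isDownSetIncompatibility : ∀ {θ} → NotNegation θ → IsDownSetIncompatibility (neg θ) θ
neg-isDownSetIncompatibility (var p) s = id , id
neg-isDownSetIncompatibility bot     s = id , id
neg-isDownSetIncompatibility (φ ∧̇ ψ) s = id , id
neg-isDownSetIncompatibility (φ ∨̇ ψ) s = id , id
neg-isDownSetIncompatibility (M φ)   s = id , id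

neg-downSetIncompatibleEitherSide : ∀ θ → DownSetIncompatibleEitherSide θ (neg θ)
neg-downSetIncompatibleEitherSide (neg (neg θ)) = neg-downSetIncompatibleEitherSide θ
neg-downSetIncompatibleEitherSide (neg (var p)) = inj₂ (neg-isDownSetIncompatibility (var p))
neg-downSetIncompatibleEitherSide (neg bot)     = inj₂ (neg-isDownSetIncompatibility bot)
neg-downSetIncompatibleEitherSide (neg (φ ∧̇ ψ)) = inj₂ (neg-isDownSetIncompatibility (φ ∧̇ ψ))
neg-downSetIncompatibleEitherSide (neg (φ ∨̇ ψ)) = inj₂ (neg-isDownSetIncompatibility (φ ∨̇ ψ))
neg-downSetIncompatibleEitherSide (neg (M φ))   = inj₂ (neg-isDownSetIncompatibility (M φ))
neg-downSetIncompatibleEitherSide (var p)       = inj₁ (neg-isDownSetIncompatibility (var p))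
neg-downSetIncompatibleEitherSide bot           = inj₁ (neg-isDownSetIncompatibility bot)
neg-downSetIncompatibleEitherSide (φ ∧̇ ψ)       = inj₁ (neg-isDownSetIncompatibility (φ ∧̇ ψ))
neg-downSetIncompatibleEitherSide (φ ∨̇ ψ)       = inj₁ (neg-isDownSetIncompatibility (φ ∨̇ ψ))
neg-downSetIncompatibleEitherSide (M φ)         = inj₁ (neg-isDownSetIncompatibility (M φ))

theorem3p11 : ∀ (φ ψ : Form) →
    (DownSetIncompatibleEitherSide φ ψ →
      Σ Form (λ θ → (φ ≡ₛ θ) × (ψ ≡ₛ neg θ) × VarsWithin θ φ ψ))
    × (Σ Form (λ θ → (φ ≡ₛ θ) × (ψ ≡ₛ neg θ)) → DownSetIncompatibleEitherSide φ ψ)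
theorem3p11 φ ψ = incompatible⇒negation , negation⇒incompatible
  where
  incompatible⇒negation : DownSetIncompatibleEitherSide φ ψ →
    Σ Form (λ θ → (φ ≡ₛ θ) × (ψ ≡ₛ neg θ) × VarsWithin θ φ ψ)
  incompatible⇒negation (inj₁ ψ-incomp-φ) =
    φ ∧̇ φ , ∧̇-idem φ , isDownSetIncompatibility⇒≡ₛneg-∧̇ ψ φ ψ-incomp-φ ,
    λ _ → inj₁ ∘ vars-∧̇-idem φ
  incompatible⇒negation (inj₂ φ-incomp-ψ) =
    neg (ψ ∧̇ ψ) , isDownSetIncompatibility⇒≡ₛneg-∧̇ φ ψ φ-incomp-ψ , ∧̇-idem ψ ,
    λ _ → inj₂ ∘ vars-∧̇-idem ψ

  negation⇒incompatible : Σ Form (λ θ → (φ ≡ₛ θ) × (ψ ≡ₛ neg θ)) →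
    DownSetIncompatibleEitherSide φ ψ
  negation⇒incompatible (θ , φ≡θ , ψ≡¬θ) =
    downSetIncompatibleEitherSide-resp φ θ ψ (neg θ) φ≡θ ψ≡¬θ
      (neg-downSetIncompatibleEitherSide θ)
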